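{- In the Lie algebra of type $A_r$ with $r\ge 3$, for all nonnegative integers $m,n,k$, \[\wp_q(m\alpha_1+n\alpha_2+k\alpha_3)=q^{m+n+k}\sum_{f=0}^{\min(m,n,k)}\ \sum_{d=0}^{\min(m-f,n-f)}\ \sum_{e=0}^{\min(n-f-d,k-f)}\left(\frac{1}{q}\right)^{d+e+2f}.\]
   Context: Type $A_r$: simple roots $\alpha_1,\dots,\alpha_r$, positive roots $\alpha_i+\alpha_{i+1}+\cdots+\alpha_j$ for $1\le i\le j\le r$. For a weight $\xi$, $\wp_q(\xi)=\sum_{j\ge 0}c_jq^j$, where $c_j$ is the number of ways to write $\xi$ as a nonnegative integral sum of exactly $j$ positive roots (counted with multiplicity). -}

module Defs where

open import Data.Nat using (ℕ; zero; suc; _+_; _*_; _∸_; _≤?_; _⊓_)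
open import Data.Nat.Properties using (_≟_)
open import Data.Integer as ℤ using (ℤ; +_; -[1+_])
open import Data.Integer.Properties as ℤP using ()
open import Data.Fin using (Fin; toℕ)
open import Data.List using (List; []; _∷_; [_]; map; concatMap; filter; length; upTo; allFin; foldr)
open import Data.Vec as V using (Vec; []; _∷_; tabulate; zipWith; replicate)
import Data.Vec.Properties as VP
open import Data.Bool using (Bool; true; false; if_then_else_; _∧_)
open import Relation.Nullary.Decidable using (⌊_⌋)

-- Weights in the root lattice of A_r, written in the basis of simple roots α₁,…,α_r.
Weight : ℕ → Set
Weight r = Vec ℕ r

-- The positive root α_i + α_{i+1} + ⋯ + α_j (indices 0-based, i ≤ j).
root : (r : ℕ) → Fin r → Fin r → Weight r
root r i j = tabulate λ t → if ⌊ toℕ i ≤? toℕ t ⌋ ∧ ⌊ toℕ t ≤? toℕ j ⌋ then 1 else 0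

posRoots : (r : ℕ) → List (Weight r)
posRoots r = concatMap (λ i → concatMap (λ j → if ⌊ toℕ i ≤? toℕ j ⌋ then [ root r i j ] else []) (allFin r)) (allFin r)

comps : (L j : ℕ) → List (Vec ℕ L)
comps zero zero = [ [] ]
comps zero (suc j) = []
comps (suc L) j = concatMap (λ a → map (a ∷_) (comps L (j ∸ a))) (upTo (suc j))

combo : {r : ℕ} (rs : List (Weight r)) → Vec ℕ (length rs) → Weight r
combo {r} [] [] = replicate r 0
combo (β ∷ rs) (a ∷ v) = zipWith _+_ (V.map (a *_) β) (combo rs v)

kostantCoeff : (r : ℕ) → Weight r → ℕ → ℕ
kostantCoeff r ξ j =
  length (filter (λ v → VP.≡-dec _≟_ (combo (posRoots r) v) ξ) (comps (length (posRoots r)) j))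

-- Laurent polynomials in q with ℕ coefficients, as coefficient functions ℤ → ℕ.
Laurent : Set
Laurent = ℤ → ℕ

℘ : (r : ℕ) → Weight r → Laurent
℘ r ξ (+ j) = kostantCoeff r ξ j
℘ r ξ -[1+ j ] = 0

monomial : ℤ → Laurent
monomial a b = if ⌊ a ℤ.≟ b ⌋ then 1 else 0

_⊕_ : Laurent → Laurent → Laurent
(f ⊕ g) b = f b + g b

zeroL : Laurent
zeroL _ = 0

sumTo : ℕ → (ℕ → Laurent) → Laurent
sumTo N F = foldr (λ x acc → F x ⊕ acc) zeroL (upTo (suc N))

ξ₃ : (r m n k : ℕ) → Weight r
ξ₃ r m n k = tabulate λ t → f (toℕ t)
  where
  f : ℕ → ℕ
  f 0 = m
  f 1 = n
  f 2 = k
  f _ = 0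

rhs : ℕ → ℕ → ℕ → Laurent
rhs m n k =
  sumTo (m ⊓ n ⊓ k) λ f →
  sumTo ((m ∸ f) ⊓ (n ∸ f)) λ d →
  sumTo ((n ∸ f ∸ d) ⊓ (k ∸ f)) λ e →
  monomial (+ (m + n + k) ℤ.- + (d + e + 2 * f))

-- Every positive root other than the six roots α_i + ⋯ + α_j with 1 ≤ i ≤ j ≤ 3 has a
-- positive coordinate where ξ = mα₁ + nα₂ + kα₃ vanishes, so it cannot occur in a
-- decomposition of ξ. If x, z, y are the multiplicities of α₁+α₂, α₁+α₂+α₃, α₂+α₃, those
-- of α₁, α₂, α₃ are forced to be m−x−z, n−x−z−y, k−z−y; hence decompositions correspond
-- to triples with x+z ≤ m, x+z+y ≤ n, z+y ≤ k, each using m+n+k−(x+y+2z) roots. With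
-- (f, d, e) = (z, x, y) these are exactly the summation ranges and exponents on the right,
-- and both sides are compared as the same sum of indicators over a box of triples.

module Submission where

open import Defs
open import Data.Bool using (if_then_else_; _∧_)
open import Data.Empty using (⊥-elim)
open import Data.Fin using (Fin; toℕ; suc)
open import Data.Fin.Patterns using (0F; 1F; 2F)
open import Data.Fin.Properties using (toℕ<n)
open import Data.Integer as ℤ using (ℤ)
import Data.Integer.Properties as ℤP
open import Data.List as List using (List; []; _∷_; _++_; [_]; length; filter; concatMap; applyUpTo; foldr)
import Data.List.Properties as List
open import Data.List.Relation.Unary.All as All using (All; []; _∷_)
open import Data.List.Relation.Unary.All.Properties using (concat⁺; map⁺; tabulate⁺)
open import Data.Nat using (ℕ; zero; suc; _+_; _*_; _∸_; _≤_; _<_; _⊓_; z≤n; s≤s)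
open import Data.Nat.Properties
open import Data.Nat.Tactic.RingSolver using (solve-∀)
open import Data.Product using (Σ-syntax; _×_; _,_)
open import Data.Vec as Vec using (Vec; []; _∷_; zipWith; lookup)
import Data.Vec.Properties as Vec
open import Function using (_∘′_; _⇔_; mk⇔; Equivalence)
open import Function.Properties.Equivalence using () renaming (sym to ⇔-sym)
open import Relation.Nullary using (Dec; yes; no; ¬_)
open import Relation.Nullary.Decidable using (⌊_⌋; _×-dec_)
open import Relation.Unary using (Pred; Decidable)
open import Relation.Binary.PropositionalEquality using (_≡_; _≢_; refl; sym; trans; cong; cong₂; subst; module ≡-Reasoning)
open import Algebra.Properties.Semiring.Sum +-*-semiring using (sum; sum-cong-≗; sum-replicate-zero; ∑-comm; *-distribˡ-sum)

-- Via ⌊_⌋, so that monomial a b is definitionally 𝟙 (a ℤ.≟ b).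
𝟙 : ∀ {p} {A : Set p} → Dec A → ℕ
𝟙 a? = if ⌊ a? ⌋ then 1 else 0

module _ {p} {A : Set p} where

  𝟙-yes : (a? : Dec A) → A → 𝟙 a? ≡ 1
  𝟙-yes (yes _) _ = refl
  𝟙-yes (no ¬a) a = ⊥-elim (¬a a)

  𝟙-no : (a? : Dec A) → ¬ A → 𝟙 a? ≡ 0
  𝟙-no (yes a) ¬a = ⊥-elim (¬a a)
  𝟙-no (no _) _ = refl

module _ {p q} {A : Set p} {B : Set q} where

  𝟙-cong : A ⇔ B → (a? : Dec A) (b? : Dec B) → 𝟙 a? ≡ 𝟙 b?
  𝟙-cong A⇔B (yes a) b? = sym (𝟙-yes b? (Equivalence.to A⇔B a))
  𝟙-cong A⇔B (no ¬a) b? = sym (𝟙-no b? (λ b → ¬a (Equivalence.from A⇔B b)))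

  𝟙-× : (a? : Dec A) (b? : Dec B) → 𝟙 (a? ×-dec b?) ≡ 𝟙 a? * 𝟙 b?
  𝟙-× (yes _) (yes _) = refl
  𝟙-× (yes _) (no _) = refl
  𝟙-× (no _) (yes _) = refl
  𝟙-× (no _) (no _) = refl

𝟙-*-cong : ∀ {p} {A : Set p} (a? : Dec A) {s t : ℕ} → (A → s ≡ t) → 𝟙 a? * s ≡ 𝟙 a? * t
𝟙-*-cong (yes a) s≡t = cong (_+ 0) (s≡t a)
𝟙-*-cong (no _) _ = refl

∑<-syntax : ℕ → (ℕ → ℕ) → ℕ
∑<-syntax n f = sum {n} λ i → f (toℕ i)

infix 10 ∑<-syntax
syntax ∑<-syntax n (λ x → e) = ∑⟨ x < n ⟩ e

module _ (n : ℕ) where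

  ∑-cong : {f g : ℕ → ℕ} → (∀ x → f x ≡ g x) → ∑⟨ x < n ⟩ f x ≡ ∑⟨ x < n ⟩ g x
  ∑-cong f≗g = sum-cong-≗ {n} (λ i → f≗g (toℕ i))

  ∑-cong-< : {f g : ℕ → ℕ} → (∀ x → x < n → f x ≡ g x) → ∑⟨ x < n ⟩ f x ≡ ∑⟨ x < n ⟩ g x
  ∑-cong-< f≗g = sum-cong-≗ {n} (λ i → f≗g (toℕ i) (toℕ<n i))

  ∑-zero : {f : ℕ → ℕ} → (∀ x → f x ≡ 0) → ∑⟨ x < n ⟩ f x ≡ 0
  ∑-zero f≗0 = trans (∑-cong f≗0) (sum-replicate-zero n)

  ∑-*ˡ : ∀ c (f : ℕ → ℕ) → ∑⟨ x < n ⟩ (c * f x) ≡ c * ∑⟨ x < n ⟩ f x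
  ∑-*ˡ c f = sym (*-distribˡ-sum {n} c (λ i → f (toℕ i)))

∑-swap : ∀ m n (g : ℕ → ℕ → ℕ) → ∑⟨ x < m ⟩ ∑⟨ y < n ⟩ g x y ≡ ∑⟨ y < n ⟩ ∑⟨ x < m ⟩ g x y
∑-swap m n g = ∑-comm {m} {n} (λ i j → g (toℕ i) (toℕ j))

∑-extend : ∀ {n B} {f : ℕ → ℕ} → n ≤ B → (∀ x → n ≤ x → f x ≡ 0) → ∑⟨ x < n ⟩ f x ≡ ∑⟨ x < B ⟩ f x
∑-extend {zero} {B} _ f≗0 = sym (∑-zero B (λ x → f≗0 x z≤n))
∑-extend {suc n} {suc B} {f} (s≤s n≤B) f≗0 =
  cong (f 0 +_) (∑-extend n≤B (λ x n≤x → f≗0 (suc x) (s≤s n≤x)))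

∑-truncate : ∀ {N B} (f : ℕ → ℕ) → N < B → ∑⟨ x < suc N ⟩ f x ≡ ∑⟨ x < B ⟩ (𝟙 (x ≤? N) * f x)
∑-truncate {N} {B} f N<B = begin
  ∑⟨ x < suc N ⟩ f x                  ≡⟨ ∑-cong-< (suc N) (λ x x≤N → sym (𝟙-*-one x (≤-pred x≤N))) ⟩
  ∑⟨ x < suc N ⟩ (𝟙 (x ≤? N) * f x)   ≡⟨ ∑-extend N<B (λ x N<x → cong (_* f x) (𝟙-no (x ≤? N) (<⇒≱ N<x))) ⟩
  ∑⟨ x < B ⟩ (𝟙 (x ≤? N) * f x)       ∎
  where
  open ≡-Reasoning
  𝟙-*-one : ∀ x → x ≤ N → 𝟙 (x ≤? N) * f x ≡ f x
  𝟙-*-one x x≤N = trans (cong (_* f x) (𝟙-yes (x ≤? N) x≤N)) (*-identityˡ (f x))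

∑-δ : ∀ {n t} (g : ℕ → ℕ) → t < n → ∑⟨ x < n ⟩ (𝟙 (x ≟ t) * g x) ≡ g t
∑-δ {suc n} {zero} g _ = begin
  1 * g 0 + ∑⟨ x < n ⟩ (𝟙 (suc x ≟ 0) * g (suc x))  ≡⟨ cong (1 * g 0 +_) (∑-zero n (λ _ → refl)) ⟩
  1 * g 0 + 0                                       ≡⟨ +-identityʳ _ ⟩
  1 * g 0                                           ≡⟨ *-identityˡ _ ⟩
  g 0                                               ∎
  where open ≡-Reasoning
∑-δ {suc n} {suc t} g (s≤s t<n) = begin
  ∑⟨ x < n ⟩ (𝟙 (suc x ≟ suc t) * g (suc x))
    ≡⟨ ∑-cong n (λ x → cong (_* g (suc x)) (𝟙-cong suc-⇔ (suc x ≟ suc t) (x ≟ t))) ⟩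
  ∑⟨ x < n ⟩ (𝟙 (x ≟ t) * g (suc x))
    ≡⟨ ∑-δ (g ∘′ suc) t<n ⟩
  g (suc t)  ∎
  where
  open ≡-Reasoning
  suc-⇔ : ∀ {x} → suc x ≡ suc t ⇔ x ≡ t
  suc-⇔ = mk⇔ suc-injective (cong suc)

m+n≡o⇔n≡o∸m : ∀ {m n o} → m ≤ o → m + n ≡ o ⇔ n ≡ o ∸ m
m+n≡o⇔n≡o∸m {m} {n} m≤o = mk⇔
  (λ m+n≡o → trans (sym (m+n∸m≡n m n)) (cong (_∸ m) m+n≡o))
  (λ n≡o∸m → trans (cong (m +_) n≡o∸m) (m+[n∸m]≡n m≤o))

∑-solve : ∀ {B} u k (g : ℕ → ℕ) → k < B → ∑⟨ c < B ⟩ (𝟙 (u + c ≟ k) * g c) ≡ 𝟙 (u ≤? k) * g (k ∸ u)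
∑-solve {B} u k g k<B with u ≤? k
... | yes u≤k = begin
  ∑⟨ c < B ⟩ (𝟙 (u + c ≟ k) * g c)
    ≡⟨ ∑-cong B (λ c → cong (_* g c) (𝟙-cong (m+n≡o⇔n≡o∸m u≤k) (u + c ≟ k) (c ≟ k ∸ u))) ⟩
  ∑⟨ c < B ⟩ (𝟙 (c ≟ k ∸ u) * g c)
    ≡⟨ ∑-δ g (≤-<-trans (m∸n≤m k u) k<B) ⟩
  g (k ∸ u)
    ≡⟨ *-identityˡ _ ⟨
  1 * g (k ∸ u)  ∎
  where open ≡-Reasoning
... | no u≰k = ∑-zero B (λ c → cong (_* g c) (𝟙-no (u + c ≟ k) (λ u+c≡k → u≰k (subst (u ≤_) u+c≡k (m≤m+n u c)))))

cubeSum : (L B : ℕ) → (Vec ℕ L → ℕ) → ℕ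
cubeSum zero B g = g []
cubeSum (suc L) B g = ∑⟨ a < B ⟩ cubeSum L B (λ v → g (a ∷ v))

cubeSum-cong : ∀ L B {f g : Vec ℕ L → ℕ} → (∀ v → f v ≡ g v) → cubeSum L B f ≡ cubeSum L B g
cubeSum-cong zero B f≗g = f≗g []
cubeSum-cong (suc L) B f≗g = ∑-cong B (λ a → cubeSum-cong L B (λ v → f≗g (a ∷ v)))

cubeSum-zero : ∀ L B {f : Vec ℕ L → ℕ} → (∀ v → f v ≡ 0) → cubeSum L B f ≡ 0
cubeSum-zero zero B f≗0 = f≗0 []
cubeSum-zero (suc L) B f≗0 = ∑-zero B (λ a → cubeSum-zero L B (λ v → f≗0 (a ∷ v)))

count : ∀ {a p} {A : Set a} {P : Pred A p} → Decidable P → List A → ℕ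
count P? xs = length (filter P? xs)

module _ {a p} {A : Set a} {P : Pred A p} (P? : Decidable P) where

  count-singleton : ∀ x → count P? [ x ] ≡ 𝟙 (P? x)
  count-singleton x with P? x
  ... | yes _ = refl
  ... | no _ = refl

  count-++ : ∀ xs ys → count P? (xs ++ ys) ≡ count P? xs + count P? ys
  count-++ xs ys = trans (cong length (List.filter-++ P? xs ys)) (List.length-++ (filter P? xs))

  count-none : ∀ xs → (∀ x → ¬ P x) → count P? xs ≡ 0
  count-none xs ¬P = cong length (List.filter-none P? (All.universal ¬P xs))

  count-concatMap : ∀ n (g : ℕ → ℕ) (f : ℕ → List A) →
    count P? (concatMap f (applyUpTo g n)) ≡ ∑⟨ x < n ⟩ count P? (f (g x))
  count-concatMap zero g f = refl
  count-concatMap (suc n) g f =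
    trans (count-++ (f (g 0)) _) (cong (count P? (f (g 0)) +_) (count-concatMap n (g ∘′ suc) f))

count-map : ∀ {a b p} {A : Set a} {B : Set b} {P : Pred B p} (P? : Decidable P) (f : A → B) xs →
  count P? (List.map f xs) ≡ count (λ x → P? (f x)) xs
count-map P? f [] = refl
count-map P? f (x ∷ xs) with P? (f x)
... | yes _ = cong suc (count-map P? f xs)
... | no _ = count-map P? f xs

count-cong : ∀ {a p q} {A : Set a} {P : Pred A p} {Q : Pred A q} (P? : Decidable P) (Q? : Decidable Q) →
  (∀ x → P x ⇔ Q x) → ∀ xs → count P? xs ≡ count Q? xs
count-cong P? Q? P⇔Q xs =
  cong length (List.filter-≐ P? Q? ((λ {x} → Equivalence.to (P⇔Q x)) , (λ {x} → Equivalence.from (P⇔Q x))) xs)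

comps-count : ∀ L {p} {P : Pred (Vec ℕ L) p} (P? : Decidable P) {J B} → J < B →
  count P? (comps L J) ≡ cubeSum L B (λ v → 𝟙 (P? v) * 𝟙 (Vec.sum v ≟ J))
comps-count zero P? {zero} _ = trans (count-singleton P? []) (sym (*-identityʳ _))
comps-count zero P? {suc J} _ = sym (*-zeroʳ (𝟙 (P? [])))
comps-count (suc L) P? {J} {B} J<B = begin
  count P? (comps (suc L) J)
    ≡⟨ count-concatMap P? (suc J) (λ a → a) (λ a → List.map (a ∷_) (comps L (J ∸ a))) ⟩
  ∑⟨ a < suc J ⟩ count P? (List.map (a ∷_) (comps L (J ∸ a)))
    ≡⟨ ∑-cong (suc J) (λ a → count-map P? (a ∷_) (comps L (J ∸ a))) ⟩
  ∑⟨ a < suc J ⟩ count (λ v → P? (a ∷ v)) (comps L (J ∸ a))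
    ≡⟨ ∑-cong (suc J) (λ a → comps-count L (λ v → P? (a ∷ v)) (≤-<-trans (m∸n≤m J a) J<B)) ⟩
  ∑⟨ a < suc J ⟩ cubeSum L B (λ v → 𝟙 (P? (a ∷ v)) * 𝟙 (Vec.sum v ≟ J ∸ a))
    ≡⟨ ∑-cong-< (suc J) (λ a a≤J → cubeSum-cong L B (λ v →
         cong (𝟙 (P? (a ∷ v)) *_)
              (𝟙-cong (⇔-sym (m+n≡o⇔n≡o∸m (≤-pred a≤J))) (Vec.sum v ≟ J ∸ a) (a + Vec.sum v ≟ J)))) ⟩
  ∑⟨ a < suc J ⟩ cubeSum L B (λ v → 𝟙 (P? (a ∷ v)) * 𝟙 (a + Vec.sum v ≟ J))
    ≡⟨ ∑-extend J<B (λ a J<a → cubeSum-zero L B (λ v →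
         trans (cong (𝟙 (P? (a ∷ v)) *_) (𝟙-no (a + Vec.sum v ≟ J) (λ a+s≡J → <⇒≱ J<a (subst (a ≤_) a+s≡J (m≤m+n a _)))))
               (*-zeroʳ (𝟙 (P? (a ∷ v)))))) ⟩
  cubeSum (suc L) B (λ v → 𝟙 (P? v) * 𝟙 (Vec.sum v ≟ J))  ∎
  where open ≡-Reasoning

sumTo-as-∑ : ∀ {N B} (F : ℕ → Laurent) b → N < B → sumTo N F b ≡ ∑⟨ x < B ⟩ (𝟙 (x ≤? N) * F x b)
sumTo-as-∑ {N} F b N<B = trans (foldr-⊕ (suc N) (λ x → x)) (∑-truncate (λ x → F x b) N<B)
  where
  foldr-⊕ : ∀ n g → foldr (λ x acc → F x ⊕ acc) zeroL (applyUpTo g n) b ≡ ∑⟨ x < n ⟩ F (g x) b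
  foldr-⊕ zero g = refl
  foldr-⊕ (suc n) g = cong (F (g 0) b +_) (foldr-⊕ n (g ∘′ suc))

_≟ᵥ_ : ∀ {r} (v w : Weight r) → Dec (v ≡ w)
_≟ᵥ_ = Vec.≡-dec _≟_

module _ {r : ℕ} where

  decompositionsFrom : Weight r → List (Weight r) → Weight r → ℕ → ℕ
  decompositionsFrom off rs ξ j = count (λ v → zipWith _+_ off (combo rs v) ≟ᵥ ξ) (comps (length rs) j)

  decompositions : List (Weight r) → Weight r → ℕ → ℕ
  decompositions rs ξ j = count (λ v → combo rs v ≟ᵥ ξ) (comps (length rs) j)

  decompositionsFrom-zero : ∀ rs ξ j → decompositionsFrom (Vec.replicate r 0) rs ξ j ≡ decompositions rs ξ j
  decompositionsFrom-zero rs ξ j =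
    count-cong (λ v → zipWith _+_ (Vec.replicate r 0) (combo rs v) ≟ᵥ ξ) (λ v → combo rs v ≟ᵥ ξ) (λ v → mk⇔
      (trans (sym (Vec.zipWith-identityˡ +-identityˡ (combo rs v))))
      (trans (Vec.zipWith-identityˡ +-identityˡ (combo rs v))))
    (comps (length rs) j)

  decompositionsFrom-∷ : ∀ off β rs ξ j → decompositionsFrom off (β ∷ rs) ξ j ≡
    ∑⟨ a < suc j ⟩ decompositionsFrom (zipWith _+_ off (Vec.map (a *_) β)) rs ξ (j ∸ a)
  decompositionsFrom-∷ off β rs ξ j = begin
    decompositionsFrom off (β ∷ rs) ξ j
      ≡⟨ count-concatMap P? (suc j) (λ a → a) (λ a → List.map (a ∷_) (comps (length rs) (j ∸ a))) ⟩
    ∑⟨ a < suc j ⟩ count P? (List.map (a ∷_) (comps (length rs) (j ∸ a)))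
      ≡⟨ ∑-cong (suc j) (λ a → count-map P? (a ∷_) (comps (length rs) (j ∸ a))) ⟩
    ∑⟨ a < suc j ⟩ count (λ w → P? (a ∷ w)) (comps (length rs) (j ∸ a))
      ≡⟨ ∑-cong (suc j) (λ a → count-cong (λ w → P? (a ∷ w)) (λ w → zipWith _+_ (shifted a) (combo rs w) ≟ᵥ ξ)
                                          (shift a) (comps (length rs) (j ∸ a))) ⟩
    ∑⟨ a < suc j ⟩ decompositionsFrom (shifted a) rs ξ (j ∸ a)  ∎
    where
    open ≡-Reasoning
    P? = λ v → zipWith _+_ off (combo (β ∷ rs) v) ≟ᵥ ξ
    shifted : ℕ → Weight r
    shifted a = zipWith _+_ off (Vec.map (a *_) β)
    shift : ∀ a w → (zipWith _+_ off (combo (β ∷ rs) (a ∷ w)) ≡ ξ) ⇔ (zipWith _+_ (shifted a) (combo rs w) ≡ ξ)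
    shift a w = mk⇔ (trans assoc) (trans (sym assoc))
      where assoc = Vec.zipWith-assoc +-assoc off (Vec.map (a *_) β) (combo rs w)

  lookup-≤-shift : ∀ off β w a (t : Fin r) →
    lookup β t ≤ lookup (zipWith _+_ (zipWith _+_ off (Vec.map (suc a *_) β)) w) t
  lookup-≤-shift off β w a t = begin
    lookup β t                                               ≤⟨ m≤m+n (lookup β t) (a * lookup β t) ⟩
    suc a * lookup β t                                       ≤⟨ m≤n+m _ (lookup off t) ⟩
    lookup off t + suc a * lookup β t                        ≤⟨ m≤m+n _ (lookup w t) ⟩
    lookup off t + suc a * lookup β t + lookup w t
      ≡⟨ cong (λ x → lookup off t + x + lookup w t) (Vec.lookup-map t (suc a *_) β) ⟨
    lookup off t + lookup (Vec.map (suc a *_) β) t + lookup w t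
      ≡⟨ cong (_+ lookup w t) (Vec.lookup-zipWith _+_ t off (Vec.map (suc a *_) β)) ⟨
    lookup (zipWith _+_ off (Vec.map (suc a *_) β)) t + lookup w t
      ≡⟨ Vec.lookup-zipWith _+_ t (zipWith _+_ off (Vec.map (suc a *_) β)) w ⟨
    lookup (zipWith _+_ (zipWith _+_ off (Vec.map (suc a *_) β)) w) t  ∎
    where open ≤-Reasoning

  Excluded : Weight r → Weight r → Set
  Excluded ξ β = Σ[ t ∈ Fin r ] lookup ξ t ≡ 0 × 0 < lookup β t

  decompositionsFrom-excluded : ∀ {ξ β} off rs j → Excluded ξ β →
    decompositionsFrom off (β ∷ rs) ξ j ≡ decompositionsFrom off rs ξ j
  decompositionsFrom-excluded {ξ} {β} off rs j (t , ξₜ≡0 , 0<βₜ) = begin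
    decompositionsFrom off (β ∷ rs) ξ j
      ≡⟨ decompositionsFrom-∷ off β rs ξ j ⟩
    decompositionsFrom (zipWith _+_ off (Vec.map (λ _ → 0) β)) rs ξ j
      + ∑⟨ a < j ⟩ decompositionsFrom (shifted (suc a)) rs ξ (j ∸ suc a)
      ≡⟨ cong₂ _+_ (cong (λ o → decompositionsFrom o rs ξ j) off+0≡off)
                   (∑-zero j (λ a → count-none (λ w → zipWith _+_ (shifted (suc a)) (combo rs w) ≟ᵥ ξ)
                                               (comps (length rs) (j ∸ suc a)) (impossible a))) ⟩
    decompositionsFrom off rs ξ j + 0
      ≡⟨ +-identityʳ _ ⟩
    decompositionsFrom off rs ξ j  ∎
    where
    open ≡-Reasoning
    shifted : ℕ → Weight r
    shifted a = zipWith _+_ off (Vec.map (a *_) β)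
    off+0≡off : zipWith _+_ off (Vec.map (λ _ → 0) β) ≡ off
    off+0≡off = trans (cong (zipWith _+_ off) (Vec.map-const β 0)) (Vec.zipWith-identityʳ +-identityʳ off)
    impossible : ∀ a w → zipWith _+_ (shifted (suc a)) (combo rs w) ≢ ξ
    impossible a w eq = <⇒≢ (<-≤-trans 0<βₜ (lookup-≤-shift off β (combo rs w) a t))
      (sym (trans (cong (λ v → lookup v t) eq) ξₜ≡0))

  data Pruning (ξ : Weight r) : List (Weight r) → List (Weight r) → Set where
    [] : Pruning ξ [] []
    keep : ∀ β {rs rs′} → Pruning ξ rs rs′ → Pruning ξ (β ∷ rs) (β ∷ rs′)
    drop : ∀ {β rs rs′} → Excluded ξ β → Pruning ξ rs rs′ → Pruning ξ (β ∷ rs) rs′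

  drop-all : ∀ {ξ ks rs rs′} → All (Excluded ξ) ks → Pruning ξ rs rs′ → Pruning ξ (ks ++ rs) rs′
  drop-all [] p = p
  drop-all (e ∷ es) p = drop e (drop-all es p)

  drop-everything : ∀ {ξ ks} → All (Excluded ξ) ks → Pruning ξ ks []
  drop-everything [] = []
  drop-everything (e ∷ es) = drop e (drop-everything es)

  decompositionsFrom-pruning : ∀ {ξ rs rs′} → Pruning ξ rs rs′ →
    ∀ off j → decompositionsFrom off rs ξ j ≡ decompositionsFrom off rs′ ξ j
  decompositionsFrom-pruning [] off j = refl
  decompositionsFrom-pruning {ξ} (keep β {rs} {rs′} p) off j = begin
    decompositionsFrom off (β ∷ rs) ξ j
      ≡⟨ decompositionsFrom-∷ off β rs ξ j ⟩
    ∑⟨ a < suc j ⟩ decompositionsFrom (zipWith _+_ off (Vec.map (a *_) β)) rs ξ (j ∸ a)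
      ≡⟨ ∑-cong (suc j) (λ a → decompositionsFrom-pruning p (zipWith _+_ off (Vec.map (a *_) β)) (j ∸ a)) ⟩
    ∑⟨ a < suc j ⟩ decompositionsFrom (zipWith _+_ off (Vec.map (a *_) β)) rs′ ξ (j ∸ a)
      ≡⟨ decompositionsFrom-∷ off β rs′ ξ j ⟨
    decompositionsFrom off (β ∷ rs′) ξ j  ∎
    where open ≡-Reasoning
  decompositionsFrom-pruning (drop {rs = rs} e p) off j =
    trans (decompositionsFrom-excluded off rs j e) (decompositionsFrom-pruning p off j)

  decompositions-pruning : ∀ {ξ rs rs′} → Pruning ξ rs rs′ → ∀ j → decompositions rs ξ j ≡ decompositions rs′ ξ j
  decompositions-pruning {ξ} {rs} {rs′} p j = begin
    decompositions rs ξ j                         ≡⟨ decompositionsFrom-zero rs ξ j ⟨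
    decompositionsFrom (Vec.replicate r 0) rs ξ j   ≡⟨ decompositionsFrom-pruning p (Vec.replicate r 0) j ⟩
    decompositionsFrom (Vec.replicate r 0) rs′ ξ j  ≡⟨ decompositionsFrom-zero rs′ ξ j ⟩
    decompositions rs′ ξ j                        ∎
    where open ≡-Reasoning

concatMap-tabulate⁺ : ∀ {a b p} {A : Set a} {B : Set b} {P : Pred B p} {n} {g : Fin n → A} (f : A → List B) →
  (∀ i → All P (f (g i))) → All P (concatMap f (List.tabulate g))
concatMap-tabulate⁺ f Pfg = concat⁺ (map⁺ (tabulate⁺ Pfg))

lookup-root-diagonal : ∀ {r} (i j : Fin r) → toℕ i ≤ toℕ j → lookup (root r i j) j ≡ 1
lookup-root-diagonal {r} i j i≤j
  rewrite Vec.lookup∘tabulate (λ t → if ⌊ toℕ i ≤? toℕ t ⌋ ∧ ⌊ toℕ t ≤? toℕ j ⌋ then 1 else 0) j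
  with toℕ i ≤? toℕ j | toℕ j ≤? toℕ j
... | yes _ | yes _ = refl
... | no i≰j | _ = ⊥-elim (i≰j i≤j)
... | yes _ | no j≰j = ⊥-elim (j≰j ≤-refl)

ξ₃-vanishes : ∀ {s} m n k (t : Fin (3 + s)) → 3 ≤ toℕ t → lookup (ξ₃ (3 + s) m n k) t ≡ 0
ξ₃-vanishes m n k 0F ()
ξ₃-vanishes m n k 1F (s≤s ())
ξ₃-vanishes m n k 2F (s≤s (s≤s ()))
ξ₃-vanishes m n k (suc (suc (suc t))) _ = Vec.lookup∘tabulate (λ _ → 0) t

cell : (r : ℕ) → Fin r → Fin r → List (Weight r)
cell r i j = if ⌊ toℕ i ≤? toℕ j ⌋ then [ root r i j ] else []

module _ {s m n k : ℕ} where

  cell-excluded : (i j : Fin (3 + s)) → (toℕ i ≤ toℕ j → 3 ≤ toℕ j) → All (Excluded (ξ₃ (3 + s) m n k)) (cell (3 + s) i j)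
  cell-excluded i j 3≤j with toℕ i ≤? toℕ j
  ... | yes i≤j = (j , ξ₃-vanishes m n k j (3≤j i≤j) , ≤-reflexive (sym (lookup-root-diagonal i j i≤j))) ∷ []
  ... | no _ = []

  high-indices : List (Fin (3 + s))
  high-indices = List.tabulate (λ t → suc (suc (suc t)))

  row-excluded : (i : Fin (3 + s)) → 3 ≤ toℕ i → All (Excluded (ξ₃ (3 + s) m n k)) (concatMap (cell (3 + s) i) (List.allFin (3 + s)))
  row-excluded i 3≤i = concatMap-tabulate⁺ (cell (3 + s) i) (λ j → cell-excluded i j (≤-trans 3≤i))

  high-cells-excluded : (i : Fin (3 + s)) → All (Excluded (ξ₃ (3 + s) m n k)) (concatMap (cell (3 + s) i) high-indices)
  high-cells-excluded i = concatMap-tabulate⁺ (cell (3 + s) i) (λ t → cell-excluded i (suc (suc (suc t))) (λ _ → s≤s (s≤s (s≤s z≤n))))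

  high-rows-excluded : All (Excluded (ξ₃ (3 + s) m n k)) (concatMap (λ i → concatMap (cell (3 + s) i) (List.allFin (3 + s))) high-indices)
  high-rows-excluded = concatMap-tabulate⁺ _ (λ t → row-excluded (suc (suc (suc t))) (s≤s (s≤s (s≤s z≤n))))

A₃-roots : ∀ s → List (Weight (3 + s))
A₃-roots s = root r 0F 0F ∷ root r 0F 1F ∷ root r 0F 2F ∷ root r 1F 1F ∷ root r 1F 2F ∷ root r 2F 2F ∷ []
  where r = 3 + s

-- posRoots lists the roots row by row in i; the columns j ≥ 3 of rows 0, 1, 2 and all rows i ≥ 3 are dropped.
posRoots-pruning : ∀ s m n k → Pruning (ξ₃ (3 + s) m n k) (posRoots (3 + s)) (A₃-roots s)
posRoots-pruning s m n k =
  keep _ (keep _ (keep _ (drop-all (high-cells-excluded 0F)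
  (keep _ (keep _ (drop-all (high-cells-excluded 1F)
  (keep _ (drop-all (high-cells-excluded 2F)
  (drop-everything high-rows-excluded)))))))))

+-map-*-zeros : ∀ {n} a (w : Vec ℕ n) → zipWith _+_ (Vec.map (a *_) (Vec.tabulate (λ _ → 0))) w ≡ w
+-map-*-zeros a [] = refl
+-map-*-zeros a (w₀ ∷ w) = cong₂ _∷_ (cong (_+ w₀) (*-zeroʳ a)) (+-map-*-zeros a w)

replicate-zero : ∀ n → Vec.replicate n 0 ≡ Vec.tabulate (λ _ → 0)
replicate-zero zero = refl
replicate-zero (suc n) = cong (0 ∷_) (replicate-zero n)

combo-A₃ : ∀ s a x z b y c →
  combo (A₃-roots s) (a ∷ x ∷ z ∷ b ∷ y ∷ c ∷ []) ≡ ξ₃ (3 + s) (x + z + a) (x + z + y + b) (z + y + c)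
combo-A₃ s a x z b y c =
  cong₂ _∷_ (coordinate₁ a x z b y c) (cong₂ _∷_ (coordinate₂ a x z b y c) (cong₂ _∷_ (coordinate₃ a x z b y c)
  (trans (+-map-*-zeros a _) (trans (+-map-*-zeros x _) (trans (+-map-*-zeros z _)
  (trans (+-map-*-zeros b _) (trans (+-map-*-zeros y _) (trans (+-map-*-zeros c _) (replicate-zero s)))))))))
  where
  coordinate₁ : ∀ a x z b y c → a * 1 + (x * 1 + (z * 1 + (b * 0 + (y * 0 + (c * 0 + 0))))) ≡ x + z + a
  coordinate₁ = solve-∀
  coordinate₂ : ∀ a x z b y c → a * 0 + (x * 1 + (z * 1 + (b * 1 + (y * 1 + (c * 0 + 0))))) ≡ x + z + y + b
  coordinate₂ = solve-∀
  coordinate₃ : ∀ a x z b y c → a * 0 + (x * 0 + (z * 1 + (b * 0 + (y * 1 + (c * 1 + 0))))) ≡ z + y + c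
  coordinate₃ = solve-∀

ξ₃-≡-⇔ : ∀ {s m n k m′ n′ k′} → ξ₃ (3 + s) m n k ≡ ξ₃ (3 + s) m′ n′ k′ ⇔ (m ≡ m′ × n ≡ n′ × k ≡ k′)
ξ₃-≡-⇔ = mk⇔ injective (λ { (refl , refl , refl) → refl })
  where
  injective : ∀ {s m n k m′ n′ k′} → ξ₃ (3 + s) m n k ≡ ξ₃ (3 + s) m′ n′ k′ → m ≡ m′ × n ≡ n′ × k ≡ k′
  injective eq with Vec.∷-injective eq
  ... | m≡m′ , eq′ with Vec.∷-injective eq′
  ... | n≡n′ , eq″ = m≡m′ , n≡n′ , Vec.∷-injectiveˡ eq″

𝟙-×₃-* : ∀ {p q t} {P : Set p} {Q : Set q} {T : Set t} (p? : Dec P) (q? : Dec Q) (t? : Dec T) u →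
  𝟙 (p? ×-dec (q? ×-dec t?)) * u ≡ 𝟙 p? * (𝟙 q? * (𝟙 t? * u))
𝟙-×₃-* p? q? t? u = begin
  𝟙 (p? ×-dec (q? ×-dec t?)) * u   ≡⟨ cong (_* u) (trans (𝟙-× p? _) (cong (𝟙 p? *_) (𝟙-× q? t?))) ⟩
  𝟙 p? * (𝟙 q? * 𝟙 t?) * u         ≡⟨ *-assoc (𝟙 p?) _ u ⟩
  𝟙 p? * (𝟙 q? * 𝟙 t? * u)         ≡⟨ cong (𝟙 p? *_) (*-assoc (𝟙 q?) (𝟙 t?) u) ⟩
  𝟙 p? * (𝟙 q? * (𝟙 t? * u))       ∎
  where open ≡-Reasoning

∑-reorder⁶ : ∀ B (F : ℕ → ℕ → ℕ → ℕ → ℕ → ℕ → ℕ) →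
  ∑⟨ a < B ⟩ ∑⟨ x < B ⟩ ∑⟨ z < B ⟩ ∑⟨ b < B ⟩ ∑⟨ y < B ⟩ ∑⟨ c < B ⟩ F a x z b y c ≡
  ∑⟨ z < B ⟩ ∑⟨ x < B ⟩ ∑⟨ y < B ⟩ ∑⟨ a < B ⟩ ∑⟨ b < B ⟩ ∑⟨ c < B ⟩ F a x z b y c
∑-reorder⁶ B F = begin
  ∑⟨ a < B ⟩ ∑⟨ x < B ⟩ ∑⟨ z < B ⟩ ∑⟨ b < B ⟩ ∑⟨ y < B ⟩ ∑⟨ c < B ⟩ F a x z b y c
    ≡⟨ ∑-swap B B (λ a x → ∑⟨ z < B ⟩ ∑⟨ b < B ⟩ ∑⟨ y < B ⟩ ∑⟨ c < B ⟩ F a x z b y c) ⟩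
  ∑⟨ x < B ⟩ ∑⟨ a < B ⟩ ∑⟨ z < B ⟩ ∑⟨ b < B ⟩ ∑⟨ y < B ⟩ ∑⟨ c < B ⟩ F a x z b y c
    ≡⟨ ∑-cong B (λ x → ∑-swap B B (λ a z → ∑⟨ b < B ⟩ ∑⟨ y < B ⟩ ∑⟨ c < B ⟩ F a x z b y c)) ⟩
  ∑⟨ x < B ⟩ ∑⟨ z < B ⟩ ∑⟨ a < B ⟩ ∑⟨ b < B ⟩ ∑⟨ y < B ⟩ ∑⟨ c < B ⟩ F a x z b y c
    ≡⟨ ∑-cong B (λ x → ∑-cong B (λ z → ∑-cong B (λ a → ∑-swap B B (λ b y → ∑⟨ c < B ⟩ F a x z b y c)))) ⟩
  ∑⟨ x < B ⟩ ∑⟨ z < B ⟩ ∑⟨ a < B ⟩ ∑⟨ y < B ⟩ ∑⟨ b < B ⟩ ∑⟨ c < B ⟩ F a x z b y c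
    ≡⟨ ∑-cong B (λ x → ∑-cong B (λ z → ∑-swap B B (λ a y → ∑⟨ b < B ⟩ ∑⟨ c < B ⟩ F a x z b y c))) ⟩
  ∑⟨ x < B ⟩ ∑⟨ z < B ⟩ ∑⟨ y < B ⟩ ∑⟨ a < B ⟩ ∑⟨ b < B ⟩ ∑⟨ c < B ⟩ F a x z b y c
    ≡⟨ ∑-swap B B (λ x z → ∑⟨ y < B ⟩ ∑⟨ a < B ⟩ ∑⟨ b < B ⟩ ∑⟨ c < B ⟩ F a x z b y c) ⟩
  ∑⟨ z < B ⟩ ∑⟨ x < B ⟩ ∑⟨ y < B ⟩ ∑⟨ a < B ⟩ ∑⟨ b < B ⟩ ∑⟨ c < B ⟩ F a x z b y c  ∎
  where open ≡-Reasoning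

∑-solve₃ : ∀ {B} u v w m n k (h : ℕ → ℕ → ℕ → ℕ) → m < B → n < B → k < B →
  ∑⟨ a < B ⟩ ∑⟨ b < B ⟩ ∑⟨ c < B ⟩ (𝟙 (u + a ≟ m) * (𝟙 (v + b ≟ n) * (𝟙 (w + c ≟ k) * h a b c)))
  ≡ 𝟙 (u ≤? m) * (𝟙 (v ≤? n) * (𝟙 (w ≤? k) * h (m ∸ u) (n ∸ v) (k ∸ w)))
∑-solve₃ {B} u v w m n k h m<B n<B k<B = begin
  ∑⟨ a < B ⟩ ∑⟨ b < B ⟩ ∑⟨ c < B ⟩ (𝟙 (u + a ≟ m) * (𝟙 (v + b ≟ n) * (𝟙 (w + c ≟ k) * h a b c)))
    ≡⟨ ∑-cong B (λ a → ∑-cong B (λ b →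
         trans (∑-*ˡ B (𝟙 (u + a ≟ m)) (λ c → 𝟙 (v + b ≟ n) * (𝟙 (w + c ≟ k) * h a b c)))
               (cong (𝟙 (u + a ≟ m) *_) (∑-*ˡ B (𝟙 (v + b ≟ n)) (λ c → 𝟙 (w + c ≟ k) * h a b c))))) ⟩
  ∑⟨ a < B ⟩ ∑⟨ b < B ⟩ (𝟙 (u + a ≟ m) * (𝟙 (v + b ≟ n) * ∑⟨ c < B ⟩ (𝟙 (w + c ≟ k) * h a b c)))
    ≡⟨ ∑-cong B (λ a → ∑-cong B (λ b → cong (λ t → 𝟙 (u + a ≟ m) * (𝟙 (v + b ≟ n) * t)) (∑-solve w k (h a b) k<B))) ⟩
  ∑⟨ a < B ⟩ ∑⟨ b < B ⟩ (𝟙 (u + a ≟ m) * (𝟙 (v + b ≟ n) * (𝟙 (w ≤? k) * h a b (k ∸ w))))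
    ≡⟨ ∑-cong B (λ a → trans (∑-*ˡ B (𝟙 (u + a ≟ m)) (λ b → 𝟙 (v + b ≟ n) * (𝟙 (w ≤? k) * h a b (k ∸ w))))
                             (cong (𝟙 (u + a ≟ m) *_) (∑-solve v n (λ b → 𝟙 (w ≤? k) * h a b (k ∸ w)) n<B))) ⟩
  ∑⟨ a < B ⟩ (𝟙 (u + a ≟ m) * (𝟙 (v ≤? n) * (𝟙 (w ≤? k) * h a (n ∸ v) (k ∸ w))))
    ≡⟨ ∑-solve u m (λ a → 𝟙 (v ≤? n) * (𝟙 (w ≤? k) * h a (n ∸ v) (k ∸ w))) m<B ⟩
  𝟙 (u ≤? m) * (𝟙 (v ≤? n) * (𝟙 (w ≤? k) * h (m ∸ u) (n ∸ v) (k ∸ w)))  ∎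
  where open ≡-Reasoning

module _ (m n k : ℕ) where

  Admissible : ℕ → ℕ → ℕ → Set
  Admissible x z y = x + z ≤ m × x + z + y ≤ n × z + y ≤ k

  admissible? : ∀ x z y → Dec (Admissible x z y)
  admissible? x z y = x + z ≤? m ×-dec (x + z + y ≤? n ×-dec z + y ≤? k)

  degree : ℕ → ℕ → ℕ → ℕ
  degree x z y = m + n + k ∸ (x + y + 2 * z)

  rootCount : ℕ → ℕ → ℕ → ℕ
  rootCount x z y = (m ∸ (x + z)) + (n ∸ (x + z + y)) + (k ∸ (z + y)) + (x + z + y)

  rootCount+[x+y+2z]≡m+n+k : ∀ x z y → Admissible x z y → rootCount x z y + (x + y + 2 * z) ≡ m + n + k
  rootCount+[x+y+2z]≡m+n+k x z y (x+z≤m , x+z+y≤n , z+y≤k) = begin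
    A + B + C + (x + z + y) + (x + y + 2 * z)          ≡⟨ regroup A B C x z y ⟩
    (A + (x + z)) + (B + (x + z + y)) + (C + (z + y))
      ≡⟨ cong₂ _+_ (cong₂ _+_ (m∸n+n≡m x+z≤m) (m∸n+n≡m x+z+y≤n)) (m∸n+n≡m z+y≤k) ⟩
    m + n + k  ∎
    where
    open ≡-Reasoning
    A = m ∸ (x + z)
    B = n ∸ (x + z + y)
    C = k ∸ (z + y)
    regroup : ∀ A B C x z y → A + B + C + (x + z + y) + (x + y + 2 * z) ≡ (A + (x + z)) + (B + (x + z + y)) + (C + (z + y))
    regroup = solve-∀

  rootCount≡degree : ∀ x z y → Admissible x z y → rootCount x z y ≡ degree x z y
  rootCount≡degree x z y adm = trans (sym (m+n∸n≡m _ (x + y + 2 * z))) (cong (_∸ (x + y + 2 * z)) (rootCount+[x+y+2z]≡m+n+k x z y adm))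

  exponent≡degree : ∀ x z y → Admissible x z y → ℤ.+ (m + n + k) ℤ.- ℤ.+ (x + y + 2 * z) ≡ ℤ.+ degree x z y
  exponent≡degree x z y adm =
    trans (ℤP.m-n≡m⊖n (m + n + k) (x + y + 2 * z)) (ℤP.⊖-≥ weight≤)
    where
    weight≤ : x + y + 2 * z ≤ m + n + k
    weight≤ = subst (x + y + 2 * z ≤_) (rootCount+[x+y+2z]≡m+n+k x z y adm) (m≤n+m (x + y + 2 * z) (rootCount x z y))

  ranges⇔admissible : ∀ x z y →
    (z ≤ m ⊓ n ⊓ k × x ≤ (m ∸ z) ⊓ (n ∸ z) × y ≤ (n ∸ z ∸ x) ⊓ (k ∸ z)) ⇔ Admissible x z y
  ranges⇔admissible x z y = mk⇔ to from
    where
    reorder : x + z + y ≡ y + (z + x)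
    reorder = trans (+-comm (x + z) y) (cong (y +_) (+-comm x z))
    to : _ → Admissible x z y
    to (z≤ , x≤ , y≤) = x+z≤m , x+z+y≤n , subst (_≤ k) (+-comm y z) (m≤o∸n⇒m+n≤o y z≤k (m≤n⊓o⇒m≤o _ _ y≤))
      where
      z≤k = m≤n⊓o⇒m≤o (m ⊓ n) k z≤
      x+z≤m = m≤o∸n⇒m+n≤o x (m≤n⊓o⇒m≤n m n (m≤n⊓o⇒m≤n (m ⊓ n) k z≤)) (m≤n⊓o⇒m≤n _ _ x≤)
      x+z≤n = m≤o∸n⇒m+n≤o x (m≤n⊓o⇒m≤o m n (m≤n⊓o⇒m≤n (m ⊓ n) k z≤)) (m≤n⊓o⇒m≤o _ _ x≤)
      x+z+y≤n = subst (_≤ n) (sym reorder)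
        (m≤o∸n⇒m+n≤o y (subst (_≤ n) (+-comm x z) x+z≤n) (subst (y ≤_) (∸-+-assoc n z x) (m≤n⊓o⇒m≤n _ _ y≤)))
    from : Admissible x z y → _
    from (x+z≤m , x+z+y≤n , z+y≤k) =
      ⊓-glb (⊓-glb (m+n≤o⇒n≤o x x+z≤m) (m+n≤o⇒n≤o x x+z≤n)) (m+n≤o⇒m≤o z z+y≤k) ,
      ⊓-glb (m+n≤o⇒m≤o∸n x x+z≤m) (m+n≤o⇒m≤o∸n x x+z≤n) ,
      ⊓-glb (subst (y ≤_) (sym (∸-+-assoc n z x)) (m+n≤o⇒m≤o∸n y (subst (_≤ n) reorder x+z+y≤n)))
            (m+n≤o⇒m≤o∸n y (subst (_≤ k) (+-comm z y) z+y≤k))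
      where
      x+z≤n = m+n≤o⇒m≤o (x + z) x+z+y≤n

admissibleSum : (m n k B : ℕ) → Laurent
admissibleSum m n k B b = ∑⟨ z < B ⟩ ∑⟨ x < B ⟩ ∑⟨ y < B ⟩ (𝟙 (admissible? m n k x z y) * monomial (ℤ.+ degree m n k x z y) b)

admissibleSum-negative : ∀ m n k B j → admissibleSum m n k B ℤ.-[1+ j ] ≡ 0
admissibleSum-negative m n k B j = ∑-zero B (λ z → ∑-zero B (λ x → ∑-zero B (λ y → *-zeroʳ (𝟙 (admissible? m n k x z y)))))

monomial-+ : ∀ d j → monomial (ℤ.+ d) (ℤ.+ j) ≡ 𝟙 (d ≟ j)
monomial-+ d j = 𝟙-cong (mk⇔ ℤP.+-injective (cong (λ t → ℤ.+ t))) (ℤ.+ d ℤ.≟ ℤ.+ j) (d ≟ j)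

A₃-summand : ∀ s m n k j a x z b y c →
  𝟙 (combo (A₃-roots s) (a ∷ x ∷ z ∷ b ∷ y ∷ c ∷ []) ≟ᵥ ξ₃ (3 + s) m n k) * 𝟙 (a + (x + (z + (b + (y + (c + 0))))) ≟ j)
  ≡ 𝟙 (x + z + a ≟ m) * (𝟙 (x + z + y + b ≟ n) * (𝟙 (z + y + c ≟ k) * 𝟙 (a + b + c + (x + z + y) ≟ j)))
A₃-summand s m n k j a x z b y c = begin
  𝟙 (combo (A₃-roots s) (a ∷ x ∷ z ∷ b ∷ y ∷ c ∷ []) ≟ᵥ ξ₃ (3 + s) m n k) * 𝟙 (a + (x + (z + (b + (y + (c + 0))))) ≟ j)
    ≡⟨ cong₂ _*_ (𝟙-cong combo≡ξ₃⇔ (combo (A₃-roots s) (a ∷ x ∷ z ∷ b ∷ y ∷ c ∷ []) ≟ᵥ ξ₃ (3 + s) m n k)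
                                   (x + z + a ≟ m ×-dec (x + z + y + b ≟ n ×-dec z + y + c ≟ k)))
                 (cong (λ t → 𝟙 (t ≟ j)) (total a x z b y c)) ⟩
  𝟙 (x + z + a ≟ m ×-dec (x + z + y + b ≟ n ×-dec z + y + c ≟ k)) * 𝟙 (a + b + c + (x + z + y) ≟ j)
    ≡⟨ 𝟙-×₃-* (x + z + a ≟ m) (x + z + y + b ≟ n) (z + y + c ≟ k) (𝟙 (a + b + c + (x + z + y) ≟ j)) ⟩
  𝟙 (x + z + a ≟ m) * (𝟙 (x + z + y + b ≟ n) * (𝟙 (z + y + c ≟ k) * 𝟙 (a + b + c + (x + z + y) ≟ j)))  ∎
  where
  open ≡-Reasoning
  combo≡ξ₃⇔ : (combo (A₃-roots s) (a ∷ x ∷ z ∷ b ∷ y ∷ c ∷ []) ≡ ξ₃ (3 + s) m n k)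
              ⇔ (x + z + a ≡ m × x + z + y + b ≡ n × z + y + c ≡ k)
  combo≡ξ₃⇔ = mk⇔ (λ eq → Equivalence.to ξ₃-≡-⇔ (trans (sym (combo-A₃ s a x z b y c)) eq))
                  (λ eqs → trans (combo-A₃ s a x z b y c) (Equivalence.from ξ₃-≡-⇔ eqs))
  total : ∀ a x z b y c → a + (x + (z + (b + (y + (c + 0))))) ≡ a + b + c + (x + z + y)
  total = solve-∀

A₃-decompositions : ∀ s m n k j {B} → m + n + k + j < B →
  decompositions (A₃-roots s) (ξ₃ (3 + s) m n k) j ≡ admissibleSum m n k B (ℤ.+ j)
A₃-decompositions s m n k j {B} bound = begin
  decompositions (A₃-roots s) (ξ₃ (3 + s) m n k) j
    ≡⟨ comps-count 6 (λ v → combo (A₃-roots s) v ≟ᵥ ξ₃ (3 + s) m n k) (below (m≤n+m j _)) ⟩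
  ∑⟨ a < B ⟩ ∑⟨ x < B ⟩ ∑⟨ z < B ⟩ ∑⟨ b < B ⟩ ∑⟨ y < B ⟩ ∑⟨ c < B ⟩ F a x z b y c
    ≡⟨ ∑-reorder⁶ B F ⟩
  ∑⟨ z < B ⟩ ∑⟨ x < B ⟩ ∑⟨ y < B ⟩ ∑⟨ a < B ⟩ ∑⟨ b < B ⟩ ∑⟨ c < B ⟩ F a x z b y c
    ≡⟨ ∑-cong B (λ z → ∑-cong B (λ x → ∑-cong B (λ y →
         trans (∑-cong B (λ a → ∑-cong B (λ b → ∑-cong B (λ c → A₃-summand s m n k j a x z b y c))))
               (∑-solve₃ (x + z) (x + z + y) (z + y) m n k (λ a b c → 𝟙 (a + b + c + (x + z + y) ≟ j))
                         (below m≤total) (below n≤total) (below k≤total))))) ⟩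
  ∑⟨ z < B ⟩ ∑⟨ x < B ⟩ ∑⟨ y < B ⟩ (𝟙 (x + z ≤? m) * (𝟙 (x + z + y ≤? n) * (𝟙 (z + y ≤? k) *
    𝟙 (rootCount m n k x z y ≟ j))))
    ≡⟨ ∑-cong B (λ z → ∑-cong B (λ x → ∑-cong B (λ y →
         trans (sym (𝟙-×₃-* (x + z ≤? m) (x + z + y ≤? n) (z + y ≤? k) _))
               (𝟙-*-cong (admissible? m n k x z y) (λ adm →
                 trans (cong (λ t → 𝟙 (t ≟ j)) (rootCount≡degree m n k x z y adm)) (sym (monomial-+ (degree m n k x z y) j))))))) ⟩
  admissibleSum m n k B (ℤ.+ j)  ∎
  where
  open ≡-Reasoning
  F : ℕ → ℕ → ℕ → ℕ → ℕ → ℕ → ℕ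
  F a x z b y c = 𝟙 (combo (A₃-roots s) (a ∷ x ∷ z ∷ b ∷ y ∷ c ∷ []) ≟ᵥ ξ₃ (3 + s) m n k)
                * 𝟙 (a + (x + (z + (b + (y + (c + 0))))) ≟ j)
  below : ∀ {t} → t ≤ m + n + k + j → t < B
  below t≤ = ≤-<-trans t≤ bound
  m≤total : m ≤ m + n + k + j
  m≤total = ≤-trans (≤-trans (m≤m+n m n) (m≤m+n _ k)) (m≤m+n _ j)
  n≤total : n ≤ m + n + k + j
  n≤total = ≤-trans (≤-trans (m≤n+m n m) (m≤m+n _ k)) (m≤m+n _ j)
  k≤total : k ≤ m + n + k + j
  k≤total = ≤-trans (m≤n+m k (m + n)) (m≤m+n _ j)

∑-distrib³ : ∀ B (p : ℕ → ℕ) (q : ℕ → ℕ → ℕ) (g : ℕ → ℕ → ℕ → ℕ) →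
  ∑⟨ z < B ⟩ (p z * ∑⟨ x < B ⟩ (q z x * ∑⟨ y < B ⟩ g z x y))
  ≡ ∑⟨ z < B ⟩ ∑⟨ x < B ⟩ ∑⟨ y < B ⟩ (p z * (q z x * g z x y))
∑-distrib³ B p q g = ∑-cong B (λ z → begin
  p z * ∑⟨ x < B ⟩ (q z x * ∑⟨ y < B ⟩ g z x y)       ≡⟨ ∑-*ˡ B (p z) (λ x → q z x * ∑⟨ y < B ⟩ g z x y) ⟨
  ∑⟨ x < B ⟩ (p z * (q z x * ∑⟨ y < B ⟩ g z x y))     ≡⟨ ∑-cong B (λ x → cong (p z *_) (∑-*ˡ B (q z x) (g z x))) ⟨
  ∑⟨ x < B ⟩ (p z * ∑⟨ y < B ⟩ (q z x * g z x y))     ≡⟨ ∑-cong B (λ x → ∑-*ˡ B (p z) (λ y → q z x * g z x y)) ⟨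
  ∑⟨ x < B ⟩ ∑⟨ y < B ⟩ (p z * (q z x * g z x y))     ∎)
  where open ≡-Reasoning

rhs≡admissibleSum : ∀ m n k {B} → m + n + k < B → ∀ b → rhs m n k b ≡ admissibleSum m n k B b
rhs≡admissibleSum m n k {B} bound b = begin
  rhs m n k b
    ≡⟨ sumTo-as-∑ (λ z → sumTo (U₂ z) (λ x → sumTo (U₃ z x) (term z x))) b (below U₁≤m) ⟩
  ∑⟨ z < B ⟩ (𝟙 (z ≤? U₁) * sumTo (U₂ z) (λ x → sumTo (U₃ z x) (term z x)) b)
    ≡⟨ ∑-cong B (λ z → cong (𝟙 (z ≤? U₁) *_) (trans (sumTo-as-∑ (λ x → sumTo (U₃ z x) (term z x)) b (below (U₂≤m z)))
         (∑-cong B (λ x → cong (𝟙 (x ≤? U₂ z) *_) (sumTo-as-∑ (term z x) b (below (U₃≤k z x)))))) ) ⟩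
  ∑⟨ z < B ⟩ (𝟙 (z ≤? U₁) * ∑⟨ x < B ⟩ (𝟙 (x ≤? U₂ z) * ∑⟨ y < B ⟩ (𝟙 (y ≤? U₃ z x) * term z x y b)))
    ≡⟨ ∑-distrib³ B (λ z → 𝟙 (z ≤? U₁)) (λ z x → 𝟙 (x ≤? U₂ z)) (λ z x y → 𝟙 (y ≤? U₃ z x) * term z x y b) ⟩
  ∑⟨ z < B ⟩ ∑⟨ x < B ⟩ ∑⟨ y < B ⟩ (𝟙 (z ≤? U₁) * (𝟙 (x ≤? U₂ z) * (𝟙 (y ≤? U₃ z x) * term z x y b)))
    ≡⟨ ∑-cong B (λ z → ∑-cong B (λ x → ∑-cong B (λ y → begin
         𝟙 (z ≤? U₁) * (𝟙 (x ≤? U₂ z) * (𝟙 (y ≤? U₃ z x) * term z x y b))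
           ≡⟨ 𝟙-×₃-* (z ≤? U₁) (x ≤? U₂ z) (y ≤? U₃ z x) (term z x y b) ⟨
         𝟙 (z ≤? U₁ ×-dec (x ≤? U₂ z ×-dec y ≤? U₃ z x)) * term z x y b
           ≡⟨ cong (_* term z x y b) (𝟙-cong (ranges⇔admissible m n k x z y)
                (z ≤? U₁ ×-dec (x ≤? U₂ z ×-dec y ≤? U₃ z x)) (admissible? m n k x z y)) ⟩
         𝟙 (admissible? m n k x z y) * term z x y b
           ≡⟨ 𝟙-*-cong (admissible? m n k x z y) (λ adm → cong (λ e → monomial e b) (exponent≡degree m n k x z y adm)) ⟩
         𝟙 (admissible? m n k x z y) * monomial (ℤ.+ degree m n k x z y) b  ∎))) ⟩
  admissibleSum m n k B b  ∎
  where
  open ≡-Reasoning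
  U₁ = m ⊓ n ⊓ k
  U₂ = λ z → (m ∸ z) ⊓ (n ∸ z)
  U₃ = λ z x → (n ∸ z ∸ x) ⊓ (k ∸ z)
  term : ℕ → ℕ → ℕ → Laurent
  term z x y = monomial (ℤ.+ (m + n + k) ℤ.- ℤ.+ (x + y + 2 * z))
  below : ∀ {t} → t ≤ m + n + k → t < B
  below t≤ = ≤-<-trans t≤ bound
  U₁≤m : U₁ ≤ m + n + k
  U₁≤m = ≤-trans (≤-trans (m⊓n≤m (m ⊓ n) k) (m⊓n≤m m n)) (≤-trans (m≤m+n m n) (m≤m+n _ k))
  U₂≤m : ∀ z → U₂ z ≤ m + n + k
  U₂≤m z = ≤-trans (≤-trans (m⊓n≤m (m ∸ z) (n ∸ z)) (m∸n≤m m z)) (≤-trans (m≤m+n m n) (m≤m+n _ k))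
  U₃≤k : ∀ z x → U₃ z x ≤ m + n + k
  U₃≤k z x = ≤-trans (≤-trans (m⊓n≤n (n ∸ z ∸ x) (k ∸ z)) (m∸n≤m k z)) (m≤n+m k (m + n))

proposition5p1 : (r : ℕ) → 3 ≤ r → (m n k : ℕ) → (a : ℤ) →
    ℘ r (ξ₃ r m n k) a ≡ rhs m n k a
proposition5p1 (suc (suc (suc s))) (s≤s (s≤s (s≤s _))) m n k (ℤ.+ j) = begin
  ℘ (3 + s) (ξ₃ (3 + s) m n k) (ℤ.+ j)              ≡⟨ decompositions-pruning (posRoots-pruning s m n k) j ⟩
  decompositions (A₃-roots s) (ξ₃ (3 + s) m n k) j  ≡⟨ A₃-decompositions s m n k j (n<1+n _) ⟩
  admissibleSum m n k B (ℤ.+ j)                     ≡⟨ rhs≡admissibleSum m n k (s≤s (m≤m+n (m + n + k) j)) (ℤ.+ j) ⟨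
  rhs m n k (ℤ.+ j)                                 ∎
  where
  open ≡-Reasoning
  B = suc (m + n + k + j)
proposition5p1 (suc (suc (suc s))) (s≤s (s≤s (s≤s _))) m n k ℤ.-[1+ j ] =
  sym (trans (rhs≡admissibleSum m n k (n<1+n (m + n + k)) ℤ.-[1+ j ]) (admissibleSum-negative m n k (suc (m + n + k)) j))
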